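{- Let $G$ be a simple connected graph with $p \geq 2$ vertices and diameter $d$. Let $L_0$ be any nonempty set of vertices of $G$ (the vertex set of an induced subgraph of $G$), and let $k = \max\{d(u,v) : u,v \in L_0\}$, where $d$ denotes the distance in $G$. Define $L_1 = N(L_0)\setminus L_0$ and recursively $L_{i+1} = N(L_i)\setminus (L_0\cup \cdots \cup L_i)$, where $N(S)$ is the set of vertices adjacent to some vertex of $S$; let $h$ be the largest index with $L_h \neq \emptyset$. For a vertex $v$ let $d(v,L_0)=\min\{d(v,w): w\in L_0\}$. Let $\delta = 0$ if $|L_0|\geq 2$ and $\delta = 1$ if $|L_0| = 1$. Then $$\mathrm{rn}(G) = (p-1)(d-k+1)+\delta-2\sum_{i=0}^{h}|L_i|\, i$$ holds if and only if there exist a radio labeling $\varphi$ of $G$ and an ordering $x_0,x_1,\dots,x_{p-1}$ of $V(G)$ with $0=\varphi(x_0)<\varphi(x_1)<\cdots<\varphi(x_{p-1}) = \mathrm{span}(\varphi) = \mathrm{rn}(G)$ such that all of the following hold for $0\leq i\leq p-2$: (a) $d(x_i,x_{i+1}) = d(x_i,L_0)+d(x_{i+1},L_0)+k$; (b) $x_0,x_{p-1}\in L_0$ if $|L_0|\geq 2$, and $x_0\in L_0$, $x_{p-1}\in L_1$ if $|L_0|=1$; (c) $\varphi(x_0)=0$ and $\varphi(x_{i+1}) = \varphi(x_i)+d+1-d(x_i,L_0)-d(x_{i+1},L_0)-k$.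
   Context: A radio labeling of a connected graph $G$ is a map $\varphi: V(G)\to\{0,1,2,\dots\}$ such that $d(u,v)+|\varphi(u)-\varphi(v)| \geq \mathrm{diam}(G)+1$ for every pair of distinct vertices $u,v$, where $d(u,v)$ is the graph distance and $\mathrm{diam}(G)$ the diameter. The span of $\varphi$ is $\max\{|\varphi(u)-\varphi(v)| : u,v\in V(G)\}$, and the radio number $\mathrm{rn}(G)$ is the minimum span over all radio labelings of $G$. Note that $L_i$ is exactly the set of vertices at distance $i$ from $L_0$. -}

module Defs where

open import Data.Nat using (ℕ; zero; suc; _+_; _*_; _∸_; _≤_; _<_; _⊔_; _⊓_; ∣_-_∣)
open import Data.Bool using (Bool; true; false; _∧_; _∨_; not; if_then_else_; T)
open import Data.Fin using (Fin; toℕ; _≟_)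
open import Data.Fin.Subset using (Subset; ∣_∣)
open import Data.Vec using (lookup)
open import Data.List using (List; allFin; foldr; map; upTo)
open import Data.Bool.ListAction using (any)
open import Data.Nat.ListAction using (sum)
open import Data.Product using (Σ; ∃; ∃-syntax; _×_; _,_)
open import Data.Integer as ℤ using (ℤ; +_)
open import Relation.Binary.PropositionalEquality using (_≡_; _≢_)
open import Relation.Nullary.Decidable using (⌊_⌋)
open import Function.Definitions using (Bijective)

record Graph (p : ℕ) : Set where
  field
    adj    : Fin p → Fin p → Bool
    sym    : ∀ u v → adj u v ≡ adj v u
    irrefl : ∀ u → adj u u ≡ false
open Graph public

module _ {p : ℕ} (G : Graph p) where

  reach : ℕ → Fin p → Fin p → Bool
  reach zero    u v = ⌊ u ≟ v ⌋
  reach (suc n) u v = reach n u v ∨ any (λ w → reach n u w ∧ adj G w v) (allFin p)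

  Connected : Set
  Connected = ∀ u v → ∃[ n ] T (reach n u v)

  distSearch : Fin p → Fin p → ℕ → ℕ → ℕ
  distSearch u v zero       n = n
  distSearch u v (suc fuel) n = if reach n u v then n else distSearch u v fuel (suc n)

  -- graph distance d(u,v): least n with a walk of length ≤ n (≤ p-1 when connected)
  dist : Fin p → Fin p → ℕ
  dist u v = distSearch u v p 0

  maxOver : {A : Set} → List A → (A → ℕ) → ℕ
  maxOver xs f = foldr (λ a m → f a ⊔ m) 0 xs

  diam : ℕ
  diam = maxOver (allFin p) (λ u → maxOver (allFin p) (λ v → dist u v))

  IsRadioLabeling : (Fin p → ℕ) → Set
  IsRadioLabeling φ = ∀ u v → u ≢ v → suc diam ≤ dist u v + ∣ φ u - φ v ∣

  span : (Fin p → ℕ) → ℕ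
  span φ = maxOver (allFin p) (λ u → maxOver (allFin p) (λ v → ∣ φ u - φ v ∣))

  IsRadioNumber : ℕ → Set
  IsRadioNumber r =
    (∃[ φ ] (IsRadioLabeling φ × span φ ≡ r)) × (∀ φ → IsRadioLabeling φ → r ≤ span φ)

  module _ (L0 : Subset p) where

    -- d(v, L0) = min { d(v,w) : w ∈ L0 }  (L0 nonempty; p is an upper bound)
    distL0 : Fin p → ℕ
    distL0 v = foldr (λ w acc → if lookup L0 w then dist v w ⊓ acc else acc) p (allFin p)

    kL0 : ℕ
    kL0 = maxOver (allFin p) (λ u → maxOver (allFin p)
            (λ v → if lookup L0 u ∧ lookup L0 v then dist u v else 0))

    δL0 : ℕ
    δL0 = if ⌊ ∣ L0 ∣ Data.Nat.≟ 1 ⌋ then 1 else 0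

    inLayer : ℕ → Fin p → Bool
    upto    : ℕ → Fin p → Bool
    inLayer zero    v = lookup L0 v
    inLayer (suc i) v = not (upto i v) ∧ any (λ w → inLayer i w ∧ adj G w v) (allFin p)
    upto zero    v = inLayer zero v
    upto (suc i) v = upto i v ∨ inLayer (suc i) v

    layerSize : ℕ → ℕ
    layerSize i = sum (map (λ v → if inLayer i v then 1 else 0) (allFin p))

    -- Σ_{i=0}^{p-1} |L_i| · i   (layers L_i with i > h are empty, and h ≤ p-1)
    layerSum : ℕ
    layerSum = sum (map (λ i → layerSize i * i) (upTo p))

    -- The right-hand side of the characterization, for a labeling φ and an
    -- ordering x_0, …, x_{p-1} (x i = x_{toℕ i}) of the vertices, and r = rn(G).
    GoodOrdering : ℕ → (Fin p → ℕ) → (Fin p → Fin p) → Set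
    GoodOrdering r φ x =
      IsRadioLabeling φ × Bijective _≡_ _≡_ x
      × (∀ i → toℕ i ≡ 0 → φ (x i) ≡ 0)
      × (∀ i j → toℕ j ≡ suc (toℕ i) → φ (x i) < φ (x j))
      × (∀ i → toℕ i ≡ p ∸ 1 → φ (x i) ≡ span φ)
      × span φ ≡ r
      × (∀ i j → toℕ j ≡ suc (toℕ i) →
           dist (x i) (x j) ≡ distL0 (x i) + distL0 (x j) + kL0)
      × (∀ i → toℕ i ≡ 0 → T (lookup L0 (x i)))
      × (∀ i → toℕ i ≡ p ∸ 1 →
           (2 ≤ ∣ L0 ∣ → T (lookup L0 (x i))) × (∣ L0 ∣ ≡ 1 → T (inLayer 1 (x i))))
      × (∀ i j → toℕ j ≡ suc (toℕ i) →
           + φ (x j) ≡ ((((+ φ (x i)) ℤ.+ + (diam + 1)) ℤ.- + distL0 (x i))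
                          ℤ.- + distL0 (x j)) ℤ.- + kL0)

-- Let x₀, …, x_{p−1} list the vertices by increasing label of a radio labeling φ with φ(x₀) = 0,
-- and write dep v = d(v, L₀). The radio condition and a detour through L₀ give
--   φ(x_{i+1}) − φ(x_i) ≥ diam + 1 − d(x_i, x_{i+1}) ≥ diam + 1 − k − dep x_i − dep x_{i+1}.
-- Summing over i, every depth is counted twice except those of the two ends, and Σ_v dep v = Σ_i |L_i| i,
-- so span φ ≥ (p−1)(diam − k + 1) − 2 Σ_i |L_i| i + dep x₀ + dep x_{p−1}, with dep x₀ + dep x_{p−1} ≥ δ.
-- So the formula holds iff an optimal labeling attains this bound: every step is tight, which gives
-- (a) and (c), and dep x₀ + dep x_{p−1} = δ, which gives (b) once the end lying in L₀ comes first
-- (relabelling by rn(G) − φ reverses the listing).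

module Submission where

open import Defs hiding (sym)
open import Data.Nat as ℕ using (ℕ; zero; suc; _+_; _*_; _∸_; _≤_; _<_; _⊓_; z≤n; s≤s; ∣_-_∣; _≤′_; ≤′-refl; ≤′-step)
open import Data.Nat.Properties hiding (_≟_)
open import Data.Nat.ListAction using () renaming (sum to sumˡ)
open import Data.Bool using (Bool; true; false; _∧_; not; if_then_else_; T)
open import Data.Bool.Properties using (T-∧; T-∨; T-≡; T-not-≡; ¬-not)
open import Data.Bool.ListAction using (any)
open import Data.Fin using (Fin; zero; suc; toℕ; fromℕ; fromℕ<; inject₁; punchOut; _≟_)
import Data.Fin as Fin
open import Data.Fin.Properties using (punchInᵢ≢i; punchOut-injective; injective⇒≤; any?; toℕ-fromℕ<; toℕ-fromℕ; toℕ-injective; toℕ-inject₁; ≤fromℕ)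
open import Data.Fin.Subset using (Subset; _∈_; _⊆_; ∣_∣; ⁅_⁆; Nonempty)
open import Data.Fin.Subset.Properties using (p⊆q⇒∣p∣≤∣q∣; p⊂q⇒∣p∣<∣q∣; ∣⁅x⁆∣≡1; x∈⁅y⁆⇒x≡y; ∣p∣≤n; ∣p∣≡n⇒p≡⊤; ∈⊤; ∣⊤∣≡n)
open import Data.List using (List; []; _∷_; allFin; foldr; tabulate; applyUpTo)
open import Data.List.Properties using (map-tabulate; map-upTo)
open import Data.List.Membership.Propositional using (lose) renaming (_∈_ to _∈ˡ_)
open import Data.List.Membership.Propositional.Properties using (∈-allFin)
open import Data.List.Relation.Unary.Any using (here; there; satisfied)
open import Data.List.Relation.Unary.Any.Properties using (any⁺; any⁻)
open import Data.Vec using (lookup)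
open import Data.Vec.Properties using ([]=⇒lookup; lookup⇒[]=; lookup∘tabulate)
import Data.Vec as Vec
open import Data.Vec.Functional using (removeAt; replicate)
open import Data.Product using (∃-syntax; _×_; _,_; proj₁; proj₂)
open import Data.Sum using (_⊎_; inj₁; inj₂)
open import Data.Empty using (⊥-elim)
open import Data.Integer as ℤ using (ℤ)
import Data.Integer.Properties as ℤP
open import Data.Integer.Tactic.RingSolver using () renaming (solve-∀ to ℤ-solve-∀)
open import Data.Nat.Tactic.RingSolver using (solve-∀)
open import Function using (_∘_; _⇔_; mk⇔; mk⤖; Equivalence; Injective; Surjective; Bijective)
open import Function.Properties.Bijection using (⤖⇒↔)
open import Function.Properties.Equivalence using () renaming (sym to ⇔-sym; trans to ⇔-trans)
open import Relation.Binary.PropositionalEquality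
open import Relation.Binary.Definitions using (tri<; tri≈; tri>)
open import Relation.Nullary using (¬_; Dec; yes; no)
open import Relation.Nullary.Decidable using (toWitness; fromWitness; T?; ¬?; _×-dec_; ⌊_⌋)
open import Algebra.Properties.Semiring.Sum +-*-semiring
  using (sum; sum-syntax; sum-cong-≗; sum-remove; sum-replicate-zero; sum-init-last; ∑-comm; ∑-distrib-+; ∑-permute; *-distribʳ-sum)

open Equivalence using (to; from)

T-any-allFin : ∀ {n} (f : Fin n → Bool) → T (any f (allFin n)) ⇔ (∃[ i ] T (f i))
T-any-allFin {n} f = mk⇔ (satisfied ∘ any⁻ f (allFin n)) (λ (i , fi) → any⁺ f (lose {xs = allFin n} (∈-allFin i) fi))

T-lookup⇔∈ : ∀ {n} {s : Subset n} {x : Fin n} → T (lookup s x) ⇔ x ∈ s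
T-lookup⇔∈ {s = s} {x} = mk⇔ (λ t → lookup⇒[]= x s (to T-≡ t)) (λ x∈s → from T-≡ ([]=⇒lookup x∈s))

∈-tabulate⇔ : ∀ {n} {f : Fin n → Bool} {x : Fin n} → x ∈ Vec.tabulate f ⇔ T (f x)
∈-tabulate⇔ {f = f} {x} = mk⇔
  (λ x∈ → subst T (lookup∘tabulate f x) (from T-lookup⇔∈ x∈))
  (λ t → to T-lookup⇔∈ (subst T (sym (lookup∘tabulate f x)) t))

module _ {p : ℕ} (G : Graph p) {A : Set} (f : A → ℕ) where

  ≤-maxOver : ∀ {x xs} → x ∈ˡ xs → f x ≤ maxOver G xs f
  ≤-maxOver (here refl) = m≤m⊔n _ _
  ≤-maxOver {xs = y ∷ _} (there x∈xs) = ≤-trans (≤-maxOver x∈xs) (m≤n⊔m (f y) _)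

  maxOver-≤ : ∀ {b} xs → (∀ {x} → x ∈ˡ xs → f x ≤ b) → maxOver G xs f ≤ b
  maxOver-≤ []       _ = z≤n
  maxOver-≤ (x ∷ xs) h = ⊔-lub (h (here refl)) (maxOver-≤ xs (h ∘ there))

module _ {p : ℕ} (G : Graph p) (g : Fin p → Fin p → ℕ) where

  maxPairs : ℕ
  maxPairs = maxOver G (allFin p) (λ u → maxOver G (allFin p) (g u))

  ≤-maxPairs : ∀ u v → g u v ≤ maxPairs
  ≤-maxPairs u v = ≤-trans (≤-maxOver G (g u) (∈-allFin v)) (≤-maxOver G _ (∈-allFin u))

  maxPairs-≤ : ∀ {b} → (∀ u v → g u v ≤ b) → maxPairs ≤ b
  maxPairs-≤ h = maxOver-≤ G _ (allFin p) (λ {u} _ → maxOver-≤ G (g u) (allFin p) (λ {v} _ → h u v))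

module _ {A : Set} (b : A → Bool) (f : A → ℕ) (z : ℕ) where

  minOn : List A → ℕ
  minOn = foldr (λ x acc → if b x then f x ⊓ acc else acc) z

  minOn-≤ : ∀ {x xs} → x ∈ˡ xs → T (b x) → minOn xs ≤ f x
  minOn-≤ {x} (here refl) bx with b x
  ... | true = m⊓n≤m _ _
  minOn-≤ {xs = y ∷ ys} (there x∈ys) bx with b y
  ... | true  = ≤-trans (m⊓n≤n _ _) (minOn-≤ x∈ys bx)
  ... | false = minOn-≤ x∈ys bx

  minOn-attained : ∀ xs → minOn xs ≡ z ⊎ ∃[ x ] (T (b x) × minOn xs ≡ f x)
  minOn-attained [] = inj₁ refl
  minOn-attained (y ∷ ys) with b y in by
  ... | false = minOn-attained ys
  ... | true with ⊓-sel (f y) (minOn ys)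
  ...   | inj₁ e = inj₂ (y , from T-≡ by , e)
  ...   | inj₂ e with minOn-attained ys
  ...     | inj₁ e′ = inj₁ (trans e e′)
  ...     | inj₂ (x , bx , e′) = inj₂ (x , bx , trans e e′)

sumˡ-tabulate : ∀ {n} (f : Fin n → ℕ) → sumˡ (tabulate f) ≡ ∑[ i < n ] f i
sumˡ-tabulate {zero}  f = refl
sumˡ-tabulate {suc n} f = cong (f zero +_) (sumˡ-tabulate (f ∘ suc))

sumˡ-applyUpTo : ∀ (f : ℕ → ℕ) n → sumˡ (applyUpTo f n) ≡ ∑[ i < n ] f (toℕ i)
sumˡ-applyUpTo f zero    = refl
sumˡ-applyUpTo f (suc n) = cong (f 0 +_) (sumˡ-applyUpTo (f ∘ suc) n)

∑-const : ∀ n c → ∑[ i < n ] c ≡ n * c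
∑-const zero    c = refl
∑-const (suc n) c = cong (c +_) (∑-const n c)

∑-mono-≤ : ∀ {n} {f g : Fin n → ℕ} → (∀ i → f i ≤ g i) → sum f ≤ sum g
∑-mono-≤ {zero}  h = z≤n
∑-mono-≤ {suc n} h = +-mono-≤ (h zero) (∑-mono-≤ (h ∘ suc))

∑-mono-≤-tight : ∀ {n} {f g : Fin n → ℕ} → (∀ i → f i ≤ g i) → sum f ≡ sum g → ∀ i → f i ≡ g i
∑-mono-≤-tight {suc n} {f} {g} h eq i with m≤n⇒m<n∨m≡n (h zero)
... | inj₁ f₀<g₀ = ⊥-elim (<-irrefl eq (+-mono-<-≤ f₀<g₀ (∑-mono-≤ (h ∘ suc))))
∑-mono-≤-tight {suc n} {f} {g} h eq zero    | inj₂ f₀≡g₀ = f₀≡g₀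
∑-mono-≤-tight {suc n} {f} {g} h eq (suc i) | inj₂ f₀≡g₀ =
  ∑-mono-≤-tight (h ∘ suc) (+-cancelˡ-≡ (f zero) _ _ (trans eq (cong (_+ _) (sym f₀≡g₀)))) i

∑-single : ∀ {n} (f : Fin n → ℕ) (j : Fin n) → (∀ i → i ≢ j → f i ≡ 0) → sum f ≡ f j
∑-single {suc n} f j zero-off = begin
  sum f                     ≡⟨ sum-remove {i = j} f ⟩
  f j + sum (removeAt f j)  ≡⟨ cong (f j +_) (sum-cong-≗ (λ i → zero-off _ (punchInᵢ≢i j i))) ⟩
  f j + sum (replicate n 0) ≡⟨ cong (f j +_) (sum-replicate-zero n) ⟩
  f j + 0                   ≡⟨ +-identityʳ (f j) ⟩
  f j                       ∎
  where open ≡-Reasoning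

+-embed⇔ : ∀ a b c e → (a + b ≡ c + e) ⇔ (ℤ.+ a ℤ.+ ℤ.+ b ≡ ℤ.+ c ℤ.+ ℤ.+ e)
+-embed⇔ a b c e = mk⇔
  (λ eq → trans (sym (ℤP.pos-+ a b)) (trans (cong ℤ.+_ eq) (ℤP.pos-+ c e)))
  (λ eq → ℤP.+-injective (trans (ℤP.pos-+ a b) (trans eq (sym (ℤP.pos-+ c e)))))

≡-⇔+≡ : ∀ (y z t : ℤ) → y ≡ z ℤ.- t ⇔ y ℤ.+ t ≡ z
≡-⇔+≡ y z t = mk⇔ (λ { refl → cancel z t }) (λ { refl → sym (uncancel y t) })
  where
  cancel : ∀ z t → z ℤ.- t ℤ.+ t ≡ z
  cancel = ℤ-solve-∀
  uncancel : ∀ y t → y ℤ.+ t ℤ.- t ≡ y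
  uncancel = ℤ-solve-∀

-- The two integer equations of the statement, with the subtractions moved across.
ℤ-formula⇔ : ∀ a b c e → (ℤ.+ a ≡ (ℤ.+ b ℤ.+ ℤ.+ c) ℤ.- ℤ.+ e) ⇔ (a + e ≡ b + c)
ℤ-formula⇔ a b c e = ⇔-trans (≡-⇔+≡ (ℤ.+ a) (ℤ.+ b ℤ.+ ℤ.+ c) (ℤ.+ e)) (⇔-sym (+-embed⇔ a e b c))

ℤ-step⇔ : ∀ a b c e f h →
          (ℤ.+ a ≡ (((ℤ.+ b ℤ.+ ℤ.+ c) ℤ.- ℤ.+ e) ℤ.- ℤ.+ f) ℤ.- ℤ.+ h) ⇔ (a + (e + f + h) ≡ b + c)
ℤ-step⇔ a b c e f h = ⇔-trans (mk⇔ to′ from′) (⇔-sym (+-embed⇔ a (e + f + h) b c))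
  where
  pos : ℤ.+ (e + f + h) ≡ ℤ.+ e ℤ.+ ℤ.+ f ℤ.+ ℤ.+ h
  pos = trans (ℤP.pos-+ (e + f) h) (cong (ℤ._+ ℤ.+ h) (ℤP.pos-+ e f))
  cancel : ∀ z e f h → z ℤ.- e ℤ.- f ℤ.- h ℤ.+ (e ℤ.+ f ℤ.+ h) ≡ z
  cancel = ℤ-solve-∀
  uncancel : ∀ y e f h → y ≡ y ℤ.+ (e ℤ.+ f ℤ.+ h) ℤ.- e ℤ.- f ℤ.- h
  uncancel = ℤ-solve-∀
  z : ℤ
  z = ℤ.+ b ℤ.+ ℤ.+ c
  to′ : ℤ.+ a ≡ z ℤ.- ℤ.+ e ℤ.- ℤ.+ f ℤ.- ℤ.+ h → ℤ.+ a ℤ.+ ℤ.+ (e + f + h) ≡ z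
  to′ eq = trans (cong₂ ℤ._+_ eq pos) (cancel z (ℤ.+ e) (ℤ.+ f) (ℤ.+ h))
  from′ : ℤ.+ a ℤ.+ ℤ.+ (e + f + h) ≡ z → ℤ.+ a ≡ z ℤ.- ℤ.+ e ℤ.- ℤ.+ f ℤ.- ℤ.+ h
  from′ eq = trans (uncancel (ℤ.+ a) (ℤ.+ e) (ℤ.+ f) (ℤ.+ h))
    (cong (λ t → t ℤ.- ℤ.+ e ℤ.- ℤ.+ f ℤ.- ℤ.+ h) (trans (cong (λ t → ℤ.+ a ℤ.+ t) (sym pos)) eq))

x∈p⇒1≤∣p∣ : ∀ {n} {s : Subset n} {x} → x ∈ s → 1 ≤ ∣ s ∣
x∈p⇒1≤∣p∣ {s = s} {x} x∈s =
  subst (_≤ ∣ s ∣) (∣⁅x⁆∣≡1 x) (p⊆q⇒∣p∣≤∣q∣ (λ y∈⁅x⁆ → subst (_∈ s) (sym (x∈⁅y⁆⇒x≡y x y∈⁅x⁆)) x∈s))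

x,y∈p⇒2≤∣p∣ : ∀ {n} {s : Subset n} {x y} → x ∈ s → y ∈ s → x ≢ y → 2 ≤ ∣ s ∣
x,y∈p⇒2≤∣p∣ {s = s} {x} {y} x∈s y∈s x≢y = subst (_< ∣ s ∣) (∣⁅x⁆∣≡1 x) (p⊂q⇒∣p∣<∣q∣ (⁅x⁆⊆s , y , y∈s , y∉⁅x⁆))
  where
  ⁅x⁆⊆s : ⁅ x ⁆ ⊆ s
  ⁅x⁆⊆s z∈⁅x⁆ = subst (_∈ s) (sym (x∈⁅y⁆⇒x≡y x z∈⁅x⁆)) x∈s
  y∉⁅x⁆ : ¬ y ∈ ⁅ x ⁆
  y∉⁅x⁆ y∈⁅x⁆ = x≢y (sym (x∈⁅y⁆⇒x≡y x y∈⁅x⁆))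

∣m∸o-n∸o∣≡∣m-n∣ : ∀ {a b c} → c ≤ a → c ≤ b → ∣ a ∸ c - b ∸ c ∣ ≡ ∣ a - b ∣
∣m∸o-n∸o∣≡∣m-n∣ {a} {b} {c} c≤a c≤b = begin
  ∣ a ∸ c - b ∸ c ∣                 ≡⟨ ∣m+n-m+o∣≡∣n-o∣ c (a ∸ c) (b ∸ c) ⟨
  ∣ c + (a ∸ c) - c + (b ∸ c) ∣     ≡⟨ cong₂ ∣_-_∣ (m+[n∸m]≡n c≤a) (m+[n∸m]≡n c≤b) ⟩
  ∣ a - b ∣                         ∎
  where open ≡-Reasoning

∣o∸m-o∸n∣≡∣m-n∣ : ∀ {a b c} → a ≤ c → b ≤ c → ∣ c ∸ a - c ∸ b ∣ ≡ ∣ a - b ∣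
∣o∸m-o∸n∣≡∣m-n∣ {a} {b} {c} a≤c b≤c = begin
  ∣ c ∸ a - c ∸ b ∣                         ≡⟨ ∣m+n-m+o∣≡∣n-o∣ (a + b) (c ∸ a) (c ∸ b) ⟨
  ∣ a + b + (c ∸ a) - a + b + (c ∸ b) ∣     ≡⟨ cong₂ ∣_-_∣ (lhs a b (c ∸ a)) (rhs a b (c ∸ b)) ⟩
  ∣ b + (a + (c ∸ a)) - a + (b + (c ∸ b)) ∣ ≡⟨ cong₂ (λ x y → ∣ b + x - a + y ∣) (m+[n∸m]≡n a≤c) (m+[n∸m]≡n b≤c) ⟩
  ∣ b + c - a + c ∣                         ≡⟨ cong₂ ∣_-_∣ (+-comm b c) (+-comm a c) ⟩
  ∣ c + b - c + a ∣                         ≡⟨ ∣m+n-m+o∣≡∣n-o∣ c b a ⟩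
  ∣ b - a ∣                                 ≡⟨ ∣-∣-comm b a ⟩
  ∣ a - b ∣                                 ∎
  where
  open ≡-Reasoning
  lhs : ∀ a b x → a + b + x ≡ b + (a + x)
  lhs = solve-∀
  rhs : ∀ a b y → a + b + y ≡ a + (b + y)
  rhs = solve-∀

-- Summing a(i) + m ≤ a(i+1) + c(i) + c(i+1): the a's telescope and every c except the
-- two at the ends is counted twice.
module _ {n : ℕ} (m : ℕ) (a c : Fin (suc n) → ℕ) where

  private
    before after : Fin n → ℕ
    before i = a (inject₁ i) + m
    after  i = a (suc i) + (c (inject₁ i) + c (suc i))

    ends : ℕ
    ends = a (fromℕ n) + (c zero + c (fromℕ n))

    ∑before : ∑[ i < n ] before i + ends ≡ a zero + n * m + (c zero + c (fromℕ n)) + ∑[ i < n ] a (suc i)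
    ∑before = begin
      ∑[ i < n ] before i + ends
        ≡⟨ cong (_+ ends) (trans (∑-distrib-+ (a ∘ inject₁) (λ _ → m)) (cong (sum (a ∘ inject₁) +_) (∑-const n m))) ⟩
      sum (a ∘ inject₁) + n * m + ends
        ≡⟨ shuffle (sum (a ∘ inject₁)) (n * m) (a (fromℕ n)) (c zero + c (fromℕ n)) ⟩
      sum (a ∘ inject₁) + a (fromℕ n) + n * m + (c zero + c (fromℕ n))
        ≡⟨ cong (λ s → s + n * m + (c zero + c (fromℕ n))) (sum-init-last a) ⟨
      a zero + sum (a ∘ suc) + n * m + (c zero + c (fromℕ n))
        ≡⟨ shuffle′ (a zero) (sum (a ∘ suc)) (n * m) (c zero + c (fromℕ n)) ⟩
      a zero + n * m + (c zero + c (fromℕ n)) + sum (a ∘ suc)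
        ∎
      where
      open ≡-Reasoning
      shuffle : ∀ s x y z → s + x + (y + z) ≡ s + y + x + z
      shuffle = solve-∀
      shuffle′ : ∀ x s y z → x + s + y + z ≡ x + y + z + s
      shuffle′ = solve-∀

    ∑after : ∑[ i < n ] after i + ends ≡ a (fromℕ n) + 2 * sum c + ∑[ i < n ] a (suc i)
    ∑after = begin
      ∑[ i < n ] after i + ends
        ≡⟨ cong (_+ ends) (trans (∑-distrib-+ (a ∘ suc) _) (cong (sum (a ∘ suc) +_) (∑-distrib-+ (c ∘ inject₁) (c ∘ suc)))) ⟩
      sum (a ∘ suc) + (sum (c ∘ inject₁) + sum (c ∘ suc)) + ends
        ≡⟨ shuffle (sum (a ∘ suc)) (sum (c ∘ inject₁)) (sum (c ∘ suc)) (a (fromℕ n)) (c zero) (c (fromℕ n)) ⟩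
      a (fromℕ n) + (sum c + ((sum (c ∘ inject₁) + c (fromℕ n)) + 0)) + sum (a ∘ suc)
        ≡⟨ cong (λ s → a (fromℕ n) + (sum c + (s + 0)) + sum (a ∘ suc)) (sum-init-last c) ⟨
      a (fromℕ n) + 2 * sum c + sum (a ∘ suc)
        ∎
      where
      open ≡-Reasoning
      shuffle : ∀ s x y l z w → s + (x + y) + (l + (z + w)) ≡ l + ((z + y) + ((x + w) + 0)) + s
      shuffle = solve-∀

  telescope-≤ : (∀ i → a (inject₁ i) + m ≤ a (suc i) + (c (inject₁ i) + c (suc i))) →
                a zero + n * m + (c zero + c (fromℕ n)) ≤ a (fromℕ n) + 2 * sum c
  telescope-≤ steps = +-cancelʳ-≤ (sum (a ∘ suc)) _ _
    (subst₂ _≤_ ∑before ∑after (+-monoˡ-≤ ends (∑-mono-≤ steps)))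

  telescope-tight : (∀ i → a (inject₁ i) + m ≤ a (suc i) + (c (inject₁ i) + c (suc i))) →
                    (a zero + n * m + (c zero + c (fromℕ n)) ≡ a (fromℕ n) + 2 * sum c) ⇔
                    (∀ i → a (inject₁ i) + m ≡ a (suc i) + (c (inject₁ i) + c (suc i)))
  telescope-tight steps = mk⇔
    (λ eq → ∑-mono-≤-tight steps (+-cancelʳ-≡ ends _ _ (trans ∑before (trans (cong (_+ sum (a ∘ suc)) eq) (sym ∑after)))))
    (λ eqs → +-cancelʳ-≡ (sum (a ∘ suc)) _ _ (trans (sym ∑before) (trans (cong (_+ ends) (sum-cong-≗ eqs)) ∑after)))

∀-consecutive⇔ : ∀ {n} {P : Fin (suc n) → Fin (suc n) → Set} →
                 (∀ i j → toℕ j ≡ suc (toℕ i) → P i j) ⇔ (∀ i → P (inject₁ i) (suc i))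
∀-consecutive⇔ {P = P} = mk⇔ (λ h i → h (inject₁ i) (suc i) (cong suc (sym (toℕ-inject₁ i)))) from′
  where
  from′ : (∀ i → P (inject₁ i) (suc i)) → ∀ i j → toℕ j ≡ suc (toℕ i) → P i j
  from′ h i (suc j) j≡1+i = subst (λ i′ → P i′ (suc j)) (toℕ-injective (trans (toℕ-inject₁ j) (suc-injective j≡1+i))) (h j)

at-zero : ∀ {n} {P : Fin (suc n) → Set} → P zero → ∀ i → toℕ i ≡ 0 → P i
at-zero p zero _ = p

at-last : ∀ {n} {P : Fin (suc n) → Set} → P (fromℕ n) → ∀ i → toℕ i ≡ n → P i
at-last {n} {P} p i i≡n = subst P (sym (toℕ-injective (trans i≡n (sym (toℕ-fromℕ n))))) p

Fin-injective⇒surjective : ∀ {n} {f : Fin n → Fin n} → Injective _≡_ _≡_ f → Surjective _≡_ _≡_ f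
Fin-injective⇒surjective {zero}  {f} f-inj ()
Fin-injective⇒surjective {suc n} {f} f-inj y with any? (λ x → f x ≟ y)
... | yes (x , fx≡y) = x , λ { refl → fx≡y }
... | no  missed     = ⊥-elim (1+n≰n (injective⇒≤ f′-inj))
  where
  f′ : Fin (suc n) → Fin n
  f′ x = punchOut {i = y} {j = f x} (λ y≡fx → missed (x , sym y≡fx))
  f′-inj : Injective _≡_ _≡_ f′
  f′-inj {x} {x′} = f-inj ∘ punchOut-injective (λ y≡fx → missed (x , sym y≡fx)) (λ y≡fx′ → missed (x′ , sym y≡fx′))

-- The vertices listed by increasing label: the vertex in position i has exactly i smaller labels.
module Sorting {n : ℕ} (φ : Fin (suc n) → ℕ) (φ-injective : Injective _≡_ _≡_ φ) where

  below : Fin (suc n) → Subset (suc n)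
  below v = Vec.tabulate (λ u → φ u ℕ.<ᵇ φ v)

  ∈-below⇔ : ∀ {u v} → u ∈ below v ⇔ φ u < φ v
  ∈-below⇔ {u} {v} = mk⇔ (<ᵇ⇒< _ _ ∘ to (∈-tabulate⇔ {f = λ w → φ w ℕ.<ᵇ φ v}))
                         (from (∈-tabulate⇔ {f = λ w → φ w ℕ.<ᵇ φ v}) ∘ <⇒<ᵇ)

  rank : Fin (suc n) → ℕ
  rank v = ∣ below v ∣

  rank<1+n : ∀ v → rank v < suc n
  rank<1+n v = subst (rank v <_) (∣⊤∣≡n (suc n)) (p⊂q⇒∣p∣<∣q∣ ((λ _ → ∈⊤) , v , ∈⊤ , <-irrefl refl ∘ to ∈-below⇔))

  rank-< : ∀ {u v} → φ u < φ v → rank u < rank v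
  rank-< {u} φu<φv = p⊂q⇒∣p∣<∣q∣
    ((λ w∈ → from ∈-below⇔ (<-trans (to ∈-below⇔ w∈) φu<φv)) , u , from ∈-below⇔ φu<φv , <-irrefl refl ∘ to ∈-below⇔)

  rank-injective : Injective _≡_ _≡_ rank
  rank-injective {u} {v} ranks with <-cmp (φ u) (φ v)
  ... | tri< φu<φv _ _ = ⊥-elim (<-irrefl ranks (rank-< φu<φv))
  ... | tri≈ _ φu≡φv _ = φ-injective φu≡φv
  ... | tri> _ _ φv<φu = ⊥-elim (<-irrefl (sym ranks) (rank-< φv<φu))

  rank-<⁻ : ∀ {u v} → rank u < rank v → φ u < φ v
  rank-<⁻ {u} {v} r< with <-cmp (φ u) (φ v)
  ... | tri< φu<φv _ _ = φu<φv
  ... | tri≈ _ φu≡φv _ = ⊥-elim (<-irrefl (cong rank (φ-injective φu≡φv)) r<)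
  ... | tri> _ _ φv<φu = ⊥-elim (<-asym r< (rank-< φv<φu))

  position : Fin (suc n) → Fin (suc n)
  position v = fromℕ< (rank<1+n v)

  position-injective : Injective _≡_ _≡_ position
  position-injective eq = rank-injective (trans (sym (toℕ-fromℕ< _)) (trans (cong toℕ eq) (toℕ-fromℕ< _)))

  sorted : Fin (suc n) → Fin (suc n)
  sorted i = proj₁ (Fin-injective⇒surjective position-injective i)

  position-sorted : ∀ i → position (sorted i) ≡ i
  position-sorted i = proj₂ (Fin-injective⇒surjective position-injective i) refl

  sorted-position : ∀ v → sorted (position v) ≡ v
  sorted-position v = position-injective (position-sorted (position v))

  sorted-bijective : Bijective _≡_ _≡_ sorted
  sorted-bijective = (λ {i} {j} eq → trans (sym (position-sorted i)) (trans (cong position eq) (position-sorted j)))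
                   , (λ v → position v , λ { refl → sorted-position v })

  rank-sorted : ∀ i → rank (sorted i) ≡ toℕ i
  rank-sorted i = trans (sym (toℕ-fromℕ< _)) (cong toℕ (position-sorted i))

  sorted-< : ∀ {i j} → i Fin.< j → φ (sorted i) < φ (sorted j)
  sorted-< {i} {j} i<j = rank-<⁻ (subst₂ _<_ (sym (rank-sorted i)) (sym (rank-sorted j)) i<j)

  sorted-≤ : ∀ {i j} → i Fin.≤ j → φ (sorted i) ≤ φ (sorted j)
  sorted-≤ i≤j with m≤n⇒m<n∨m≡n i≤j
  ... | inj₁ i<j = <⇒≤ (sorted-< i<j)
  ... | inj₂ i≡j = ≤-reflexive (cong (φ ∘ sorted) (toℕ-injective i≡j))

  sorted-least : ∀ v → φ (sorted zero) ≤ φ v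
  sorted-least v = subst (λ w → φ (sorted zero) ≤ φ w) (sorted-position v) (sorted-≤ z≤n)

  sorted-greatest : ∀ v → φ v ≤ φ (sorted (fromℕ n))
  sorted-greatest v = subst (λ w → φ w ≤ φ (sorted (fromℕ n))) (sorted-position v) (sorted-≤ (≤fromℕ _))

module Walks {n : ℕ} (G : Graph (suc n)) where

  -- A record rather than T (reach G m u v), so that m, u and v can be inferred.
  record Reach (m : ℕ) (u v : Fin (suc n)) : Set where
    constructor reached
    field reachable : T (reach G m u v)
  open Reach public

  reach-refl : ∀ {u} → Reach 0 u u
  reach-refl {u} = reached (fromWitness {a? = u ≟ u} refl)

  reach-zero : ∀ {u v} → Reach 0 u v → u ≡ v
  reach-zero (reached r) = toWitness r

  reach-suc : ∀ {m u v} → Reach m u v → Reach (suc m) u v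
  reach-suc (reached r) = reached (from T-∨ (inj₁ r))

  reach-mono : ∀ {l m u v} → l ≤′ m → Reach l u v → Reach m u v
  reach-mono ≤′-refl        r = r
  reach-mono (≤′-step l≤′m) r = reach-suc (reach-mono l≤′m r)

  reach-step : ∀ {m u w v} → Reach m u w → T (adj G w v) → Reach (suc m) u v
  reach-step {m} {u} {w} {v} (reached r) w~v = reached
    (from (T-∨ {reach G m u v}) (inj₂ (from (T-any-allFin _) (w , from (T-∧ {reach G m u w}) (r , w~v)))))

  reach-suc⁻ : ∀ {m u v} → Reach (suc m) u v → Reach m u v ⊎ ∃[ w ] (Reach m u w × T (adj G w v))
  reach-suc⁻ {m} {u} {v} (reached r) with to (T-∨ {reach G m u v}) r
  ... | inj₁ r′ = inj₁ (reached r′)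
  ... | inj₂ r′ with to (T-any-allFin _) r′
  ...   | w , r∧a = inj₂ (w , reached (proj₁ (to (T-∧ {reach G m u w}) r∧a)) , proj₂ (to (T-∧ {reach G m u w}) r∧a))

  reach-trans : ∀ {l m u v w} → Reach l u v → Reach m v w → Reach (l + m) u w
  reach-trans {l} {zero} r s rewrite +-identityʳ l | reach-zero s = r
  reach-trans {l} {suc m} r s rewrite +-suc l m with reach-suc⁻ s
  ... | inj₁ s′ = reach-suc (reach-trans r s′)
  ... | inj₂ (w′ , s′ , a) = reach-step (reach-trans r s′) a

  reach-sym : ∀ {m u v} → Reach m u v → Reach m v u
  reach-sym {zero} r rewrite reach-zero r = reach-refl
  reach-sym {suc m} r with reach-suc⁻ r
  ... | inj₁ r′ = reach-suc (reach-sym r′)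
  ... | inj₂ (w , r′ , w~v) = reach-trans {1} (reach-step reach-refl (subst T (Graph.sym G w _) w~v)) (reach-sym r′)

  ball : ℕ → Fin (suc n) → Subset (suc n)
  ball m u = Vec.tabulate (reach G m u)

  ∈-ball⇔ : ∀ {m u v} → v ∈ ball m u ⇔ Reach m u v
  ∈-ball⇔ {m} {u} = mk⇔ (reached ∘ to (∈-tabulate⇔ {f = reach G m u})) (from (∈-tabulate⇔ {f = reach G m u}) ∘ reachable)

  Closed : ℕ → Fin (suc n) → Set
  Closed m u = ∀ {l v} → Reach l u v → Reach m u v

  stationary⇒closed : ∀ {m u} → (∀ {v} → Reach (suc m) u v → Reach m u v) → Closed m u
  stationary⇒closed stat {zero}  r = reach-mono (≤⇒≤′ z≤n) r
  stationary⇒closed stat {suc l} r with reach-suc⁻ r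
  ... | inj₁ r′ = stationary⇒closed stat r′
  ... | inj₂ (w , r′ , w~v) = stat (reach-step (stationary⇒closed stat r′) w~v)

  -- Until the balls around u stop growing, each step adds a vertex.
  ball-large⊎closed : ∀ m u → suc m ≤ ∣ ball m u ∣ ⊎ Closed m u
  ball-large⊎closed zero u = inj₁ (x∈p⇒1≤∣p∣ (from (∈-ball⇔ {0} {u}) reach-refl))
  ball-large⊎closed (suc m) u with ball-large⊎closed m u
  ... | inj₂ closed = inj₂ (reach-suc ∘ closed)
  ... | inj₁ large with any? (λ v → T? (reach G (suc m) u v) ×-dec ¬? (T? (reach G m u v)))
  ...   | yes (v , new , ¬old) = inj₁ (≤-trans (s≤s large) (p⊂q⇒∣p∣<∣q∣ (grows , v , from (∈-ball⇔ {suc m} {u}) (reached new) , ¬old ∘ reachable ∘ to (∈-ball⇔ {m} {u}))))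
    where
    grows : ball m u ⊆ ball (suc m) u
    grows = from (∈-ball⇔ {suc m} {u}) ∘ reach-suc ∘ to (∈-ball⇔ {m} {u})
  ...   | no none = inj₂ (reach-suc ∘ stationary⇒closed old)
    where
    old : ∀ {v} → Reach (suc m) u v → Reach m u v
    old {v} (reached r) with T? (reach G m u v)
    ... | yes r′ = reached r′
    ... | no ¬r′ = ⊥-elim (none (v , r , ¬r′))

  reach-connected : Connected G → ∀ u v → Reach n u v
  reach-connected conn u v with ball-large⊎closed n u
  ... | inj₂ closed = closed {proj₁ (conn u v)} (reached (proj₂ (conn u v)))
  ... | inj₁ large = to (∈-ball⇔ {n} {u}) (subst (v ∈_) (sym (∣p∣≡n⇒p≡⊤ full)) ∈⊤)
    where
    full : ∣ ball n u ∣ ≡ suc n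
    full = ≤-antisym (∣p∣≤n (ball n u)) large

module Distance {n : ℕ} (G : Graph (suc n)) (conn : Connected G) where

  open Walks G

  distSearch-≤ : ∀ u v fuel s → distSearch G u v fuel s ≤ s + fuel
  distSearch-≤ u v zero       s = ≤-reflexive (sym (+-identityʳ s))
  distSearch-≤ u v (suc fuel) s with reach G s u v
  ... | true  = m≤m+n s (suc fuel)
  ... | false = ≤-trans (distSearch-≤ u v fuel (suc s)) (≤-reflexive (sym (+-suc s fuel)))

  distSearch-first : ∀ {u v m} fuel s → s ≤ m → m < s + fuel → Reach m u v →
                     Reach (distSearch G u v fuel s) u v × distSearch G u v fuel s ≤ m
  distSearch-first {m = m} zero s s≤m m<s+0 r = ⊥-elim (<-irrefl refl (<-≤-trans (subst (m <_) (+-identityʳ s) m<s+0) s≤m))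
  distSearch-first {u} {v} {m} (suc fuel) s s≤m m<s+f r with reach G s u v in found
  ... | true  = reached (from T-≡ found) , s≤m
  ... | false with m ℕ.≟ s
  ...   | yes refl = ⊥-elim (subst T found (reachable r))
  ...   | no m≢s = distSearch-first fuel (suc s) (≤∧≢⇒< s≤m (m≢s ∘ sym)) (subst (m <_) (+-suc s fuel) m<s+f) r

  dist-least : ∀ {m u v} → Reach m u v → dist G u v ≤ m
  dist-least {m} {u} {v} r with m ℕ.<? suc n
  ... | yes m<p = proj₂ (distSearch-first (suc n) 0 z≤n m<p r)
  ... | no m≮p  = ≤-trans (distSearch-≤ u v (suc n) 0) (≮⇒≥ m≮p)

  dist-reach : ∀ u v → Reach (dist G u v) u v
  dist-reach u v = proj₁ (distSearch-first (suc n) 0 z≤n ≤-refl (reach-connected conn u v))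

  dist≤n : ∀ u v → dist G u v ≤ n
  dist≤n u v = dist-least (reach-connected conn u v)

  dist-refl : ∀ u → dist G u u ≡ 0
  dist-refl u = n≤0⇒n≡0 (dist-least reach-refl)

  dist≡0⇒≡ : ∀ {u v} → dist G u v ≡ 0 → u ≡ v
  dist≡0⇒≡ {u} {v} d≡0 = reach-zero (subst (λ m → Reach m u v) d≡0 (dist-reach u v))

  dist-sym : ∀ u v → dist G u v ≡ dist G v u
  dist-sym u v = ≤-antisym (dist-least (reach-sym (dist-reach v u))) (dist-least (reach-sym (dist-reach u v)))

  dist-triangle : ∀ u v w → dist G u w ≤ dist G u v + dist G v w
  dist-triangle u v w = dist-least (reach-trans (dist-reach u v) (dist-reach v w))

  dist-adj : ∀ {u v} → T (adj G u v) → dist G u v ≤ 1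
  dist-adj u~v = dist-least (reach-step reach-refl u~v)

  dist≤diam : ∀ u v → dist G u v ≤ diam G
  dist≤diam = ≤-maxPairs G (dist G)

module Labelings {n : ℕ} (G : Graph (suc n)) (conn : Connected G) where

  open Distance G conn

  radio-injective : ∀ {φ} → IsRadioLabeling G φ → Injective _≡_ _≡_ φ
  radio-injective {φ} radio {u} {v} φu≡φv with u ≟ v
  ... | yes u≡v = u≡v
  ... | no  u≢v = ⊥-elim (1+n≰n (begin
    suc (diam G)                 ≤⟨ radio u v u≢v ⟩
    dist G u v + ∣ φ u - φ v ∣   ≡⟨ cong (dist G u v +_) (m≡n⇒∣m-n∣≡0 φu≡φv) ⟩
    dist G u v + 0               ≡⟨ +-identityʳ _ ⟩
    dist G u v                   ≤⟨ dist≤diam u v ⟩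
    diam G                       ∎))
    where open ≤-Reasoning

  SameGaps : (φ ψ : Fin (suc n) → ℕ) → Set
  SameGaps φ ψ = ∀ u v → ∣ ψ u - ψ v ∣ ≡ ∣ φ u - φ v ∣

  radio-sameGaps : ∀ {φ ψ} → SameGaps φ ψ → IsRadioLabeling G φ → IsRadioLabeling G ψ
  radio-sameGaps gaps radio u v u≢v = subst (λ g → suc (diam G) ≤ dist G u v + g) (sym (gaps u v)) (radio u v u≢v)

  span-sameGaps : ∀ {φ ψ} → SameGaps φ ψ → span G ψ ≡ span G φ
  span-sameGaps {φ} {ψ} gaps = ≤-antisym
    (maxPairs-≤ G _ (λ u v → subst (_≤ span G φ) (sym (gaps u v)) (≤-maxPairs G _ u v)))
    (maxPairs-≤ G _ (λ u v → subst (_≤ span G ψ) (gaps u v) (≤-maxPairs G _ u v)))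

  span-from-zero : ∀ {φ bot top} → φ bot ≡ 0 → (∀ v → φ v ≤ φ top) → span G φ ≡ φ top
  span-from-zero {φ} {bot} {top} φbot≡0 highest = ≤-antisym
    (maxPairs-≤ G _ (λ u v → ≤-trans (∣m-n∣≤m⊔n (φ u) (φ v)) (⊔-lub (highest u) (highest v))))
    (subst (_≤ span G φ) (trans (cong (∣ φ top -_∣) φbot≡0) (∣-∣-identityʳ (φ top))) (≤-maxPairs G _ top bot))

  zero-based : ∀ {r} → IsRadioNumber G r → ∃[ ψ ] (IsRadioLabeling G ψ × span G ψ ≡ r × ∃[ v ] ψ v ≡ 0)
  zero-based ((φ , radio , span≡r) , _) =
    ψ , radio-sameGaps {φ} {ψ} shifted radio , trans (span-sameGaps {φ} {ψ} shifted) span≡r , sorted zero , n∸n≡0 least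
    where
    open Sorting φ (radio-injective {φ} radio)
    least : ℕ
    least = φ (sorted zero)
    ψ : Fin (suc n) → ℕ
    ψ v = φ v ∸ least
    shifted : SameGaps φ ψ
    shifted u v = ∣m∸o-n∸o∣≡∣m-n∣ (sorted-least u) (sorted-least v)

module Layers {n : ℕ} (G : Graph (suc n)) (conn : Connected G) (L0 : Subset (suc n)) (nonempty : Nonempty L0) where

  open Walks G
  open Distance G conn

  InL0 : Fin (suc n) → Set
  InL0 v = T (lookup L0 v)

  depth : Fin (suc n) → ℕ
  depth = distL0 G L0

  depth-≤ : ∀ {v w} → InL0 w → depth v ≤ dist G v w
  depth-≤ {v} {w} = minOn-≤ (lookup L0) (dist G v) (suc n) (∈-allFin w)

  depth-≤-reach : ∀ {m a v} → InL0 a → Reach m a v → depth v ≤ m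
  depth-≤-reach {a = a} {v} a∈L0 r = ≤-trans (depth-≤ a∈L0) (≤-trans (≤-reflexive (dist-sym v a)) (dist-least r))

  depth≤n : ∀ v → depth v ≤ n
  depth≤n v = ≤-trans (depth-≤ (from T-lookup⇔∈ (proj₂ nonempty))) (dist≤n v _)

  -- The fold starts from the junk value suc n, which depth≤n rules out.
  depth-attained : ∀ v → ∃[ w ] (InL0 w × depth v ≡ dist G v w)
  depth-attained v with minOn-attained (lookup L0) (dist G v) (suc n) (allFin (suc n))
  ... | inj₁ junk = ⊥-elim (<-irrefl junk (s≤s (depth≤n v)))
  ... | inj₂ attained = attained

  depth≡0⇔ : ∀ {v} → depth v ≡ 0 ⇔ InL0 v
  depth≡0⇔ {v} = mk⇔ to′ (λ v∈L0 → n≤0⇒n≡0 (≤-trans (depth-≤ v∈L0) (≤-reflexive (dist-refl v))))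
    where
    to′ : depth v ≡ 0 → InL0 v
    to′ d≡0 with depth-attained v
    ... | w , w∈L0 , d≡dist = subst InL0 (sym (dist≡0⇒≡ (trans (sym d≡dist) d≡0))) w∈L0

  depth-adj : ∀ {w v} → T (adj G w v) → depth v ≤ suc (depth w)
  depth-adj {w} {v} w~v with depth-attained w
  ... | a , a∈L0 , dw≡ = begin
    depth v                   ≤⟨ depth-≤ a∈L0 ⟩
    dist G v a                ≤⟨ dist-triangle v w a ⟩
    dist G v w + dist G w a   ≤⟨ +-monoˡ-≤ _ (≤-trans (≤-reflexive (dist-sym v w)) (dist-adj w~v)) ⟩
    1 + dist G w a            ≡⟨ cong suc (sym dw≡) ⟩
    suc (depth w)             ∎
    where open ≤-Reasoning

  depth-pred : ∀ {v i} → depth v ≡ suc i → ∃[ w ] (T (adj G w v) × depth w ≡ i)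
  depth-pred {v} {i} dv≡ with depth-attained v
  ... | a , a∈L0 , dv≡dist with reach-suc⁻ (subst (λ m → Reach m a v) (trans (dist-sym a v) (trans (sym dv≡dist) dv≡)) (dist-reach a v))
  ...   | inj₁ r = ⊥-elim (<-irrefl dv≡ (s≤s (depth-≤-reach a∈L0 r)))
  ...   | inj₂ (w , r , w~v) = w , w~v , ≤-antisym (depth-≤-reach a∈L0 r) (ℕ.s≤s⁻¹ (subst (_≤ suc (depth w)) dv≡ (depth-adj w~v)))

  LayerIs UptoIs : ℕ → Set
  LayerIs i = ∀ {v} → T (inLayer G L0 i v) ⇔ depth v ≡ i
  UptoIs  i = ∀ {v} → T (upto G L0 i v) ⇔ depth v ≤ i

  layer-suc : ∀ {i} → LayerIs i → UptoIs i → LayerIs (suc i)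
  layer-suc {i} layerᵢ uptoᵢ {v} = mk⇔ to′ from′
    where
    to′ : T (inLayer G L0 (suc i) v) → depth v ≡ suc i
    to′ t with to (T-∧ {not (upto G L0 i v)}) t
    ... | new , old with to (T-any-allFin _) old
    ...   | w , w∈Lᵢ∧w~v with to (T-∧ {inLayer G L0 i w}) w∈Lᵢ∧w~v
    ...     | w∈Lᵢ , w~v = ≤-antisym (subst (λ m → depth v ≤ suc m) (to layerᵢ w∈Lᵢ) (depth-adj w~v))
                                     (≰⇒> (λ dv≤i → subst T (to T-not-≡ new) (from uptoᵢ dv≤i)))
    from′ : depth v ≡ suc i → T (inLayer G L0 (suc i) v)
    from′ dv≡ with depth-pred dv≡
    ... | w , w~v , dw≡ = from (T-∧ {not (upto G L0 i v)})
      ( from T-not-≡ (¬-not (λ up → <-irrefl dv≡ (s≤s (to uptoᵢ (from T-≡ up)))))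
      , from (T-any-allFin _) (w , from (T-∧ {inLayer G L0 i w}) (from layerᵢ dw≡ , w~v)))

  upto-suc : ∀ {i} → UptoIs i → LayerIs (suc i) → UptoIs (suc i)
  upto-suc {i} uptoᵢ layerᵢ₊₁ {v} = mk⇔ to′ from′
    where
    to′ : T (upto G L0 (suc i) v) → depth v ≤ suc i
    to′ t with to (T-∨ {upto G L0 i v}) t
    ... | inj₁ up  = m≤n⇒m≤1+n (to uptoᵢ up)
    ... | inj₂ lay = ≤-reflexive (to layerᵢ₊₁ lay)
    from′ : depth v ≤ suc i → T (upto G L0 (suc i) v)
    from′ dv≤ with m≤n⇒m<n∨m≡n dv≤
    ... | inj₁ dv< = from (T-∨ {upto G L0 i v}) (inj₁ (from uptoᵢ (ℕ.s≤s⁻¹ dv<)))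
    ... | inj₂ dv≡ = from (T-∨ {upto G L0 i v}) (inj₂ (from layerᵢ₊₁ dv≡))

  layers : ∀ i → LayerIs i × UptoIs i
  layers zero = mk⇔ (from depth≡0⇔) (to depth≡0⇔) , mk⇔ (≤-reflexive ∘ from depth≡0⇔) (to depth≡0⇔ ∘ n≤0⇒n≡0)
  layers (suc i) = let layerᵢ , uptoᵢ = layers i ; layerᵢ₊₁ = layer-suc layerᵢ uptoᵢ in layerᵢ₊₁ , upto-suc uptoᵢ layerᵢ₊₁

  layer⇔ : ∀ i {v} → T (inLayer G L0 i v) ⇔ depth v ≡ i
  layer⇔ i = proj₁ (layers i)

  indicator : Bool → ℕ
  indicator b = if b then 1 else 0

  layerSize≡ : ∀ i → layerSize G L0 i ≡ ∑[ v < suc n ] indicator (inLayer G L0 i v)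
  layerSize≡ i = trans (cong sumˡ (map-tabulate (λ v → v) (indicator ∘ inLayer G L0 i))) (sumˡ-tabulate (indicator ∘ inLayer G L0 i))

  -- Only the layer i = depth v contributes to v's column of the double sum.
  ∑-layers-at : ∀ v → ∑[ i < suc n ] (indicator (inLayer G L0 (toℕ i) v) * toℕ i) ≡ depth v
  ∑-layers-at v = trans (∑-single _ j off) on
    where
    j : Fin (suc n)
    j = fromℕ< (s≤s (depth≤n v))
    off : ∀ i → i ≢ j → indicator (inLayer G L0 (toℕ i) v) * toℕ i ≡ 0
    off i i≢j with inLayer G L0 (toℕ i) v in eq
    ... | false = refl
    ... | true  = ⊥-elim (i≢j (toℕ-injective (trans (sym (to (layer⇔ (toℕ i)) (from T-≡ eq))) (sym (toℕ-fromℕ< _)))))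
    on : indicator (inLayer G L0 (toℕ j) v) * toℕ j ≡ depth v
    on rewrite toℕ-fromℕ< (s≤s (depth≤n v)) with inLayer G L0 (depth v) v in eq
    ... | true  = +-identityʳ (depth v)
    ... | false = ⊥-elim (subst T eq (from (layer⇔ (depth v)) refl))

  layerSum≡∑depth : layerSum G L0 ≡ ∑[ v < suc n ] depth v
  layerSum≡∑depth = begin
    layerSum G L0
      ≡⟨ cong sumˡ (map-upTo (λ i → layerSize G L0 i * i) (suc n)) ⟩
    sumˡ (applyUpTo (λ i → layerSize G L0 i * i) (suc n))
      ≡⟨ sumˡ-applyUpTo (λ i → layerSize G L0 i * i) (suc n) ⟩
    ∑[ i < suc n ] (layerSize G L0 (toℕ i) * toℕ i)
      ≡⟨ sum-cong-≗ {suc n} (λ i → trans (cong (_* toℕ i) (layerSize≡ (toℕ i))) (*-distribʳ-sum (toℕ i) (indicator ∘ inLayer G L0 (toℕ i)))) ⟩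
    ∑[ i < suc n ] ∑[ v < suc n ] (indicator (inLayer G L0 (toℕ i) v) * toℕ i)
      ≡⟨ ∑-comm {suc n} {suc n} (λ i v → indicator (inLayer G L0 (toℕ i) v) * toℕ i) ⟩
    ∑[ v < suc n ] ∑[ i < suc n ] (indicator (inLayer G L0 (toℕ i) v) * toℕ i)
      ≡⟨ sum-cong-≗ {suc n} ∑-layers-at ⟩
    ∑[ v < suc n ] depth v
      ∎
    where open ≡-Reasoning

  dist≤k : ∀ {u v} → InL0 u → InL0 v → dist G u v ≤ kL0 G L0
  dist≤k {u} {v} u∈L0 v∈L0 =
    subst (_≤ kL0 G L0) (cong (if_then dist G u v else 0) (to T-≡ (from (T-∧ {lookup L0 u}) (u∈L0 , v∈L0))))
      (≤-maxPairs G (λ a b → if lookup L0 a ∧ lookup L0 b then dist G a b else 0) u v)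

  k≤diam : kL0 G L0 ≤ diam G
  k≤diam = maxPairs-≤ G _ bounded
    where
    bounded : ∀ a b → (if lookup L0 a ∧ lookup L0 b then dist G a b else 0) ≤ diam G
    bounded a b with lookup L0 a ∧ lookup L0 b
    ... | true  = dist≤diam a b
    ... | false = z≤n

  -- Go from u to a nearest vertex of L0, across L0, and on to v.
  dist≤depth+depth+k : ∀ u v → dist G u v ≤ depth u + depth v + kL0 G L0
  dist≤depth+depth+k u v with depth-attained u | depth-attained v
  ... | a , a∈L0 , du≡ | b , b∈L0 , dv≡ = begin
    dist G u v                                ≤⟨ dist-triangle u a v ⟩
    dist G u a + dist G a v                   ≤⟨ +-monoʳ-≤ (dist G u a) (dist-triangle a b v) ⟩
    dist G u a + (dist G a b + dist G b v)    ≤⟨ +-monoʳ-≤ (dist G u a) (+-monoˡ-≤ (dist G b v) (dist≤k a∈L0 b∈L0)) ⟩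
    dist G u a + (kL0 G L0 + dist G b v)      ≡⟨ cong₂ (λ x y → x + (kL0 G L0 + y)) (sym du≡) (trans (dist-sym b v) (sym dv≡)) ⟩
    depth u + (kL0 G L0 + depth v)            ≡⟨ cong (depth u +_) (+-comm (kL0 G L0) (depth v)) ⟩
    depth u + (depth v + kL0 G L0)            ≡⟨ +-assoc (depth u) (depth v) (kL0 G L0) ⟨
    depth u + depth v + kL0 G L0              ∎
    where open ≤-Reasoning

  ∣L0∣≡1⊎2≤∣L0∣ : ∣ L0 ∣ ≡ 1 ⊎ 2 ≤ ∣ L0 ∣
  ∣L0∣≡1⊎2≤∣L0∣ with m≤n⇒m<n∨m≡n (x∈p⇒1≤∣p∣ (proj₂ nonempty))
  ... | inj₁ 1<∣L0∣ = inj₂ 1<∣L0∣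
  ... | inj₂ 1≡∣L0∣ = inj₁ (sym 1≡∣L0∣)

  δ-cases : (∣ L0 ∣ ≡ 1 × δL0 G L0 ≡ 1) ⊎ (∣ L0 ∣ ≢ 1 × δL0 G L0 ≡ 0)
  δ-cases = by-decision (∣ L0 ∣ ℕ.≟ 1)
    where
    by-decision : (d : Dec (∣ L0 ∣ ≡ 1)) → (∣ L0 ∣ ≡ 1 × indicator ⌊ d ⌋ ≡ 1) ⊎ (∣ L0 ∣ ≢ 1 × indicator ⌊ d ⌋ ≡ 0)
    by-decision (yes ∣L0∣≡1) = inj₁ (∣L0∣≡1 , refl)
    by-decision (no  ∣L0∣≢1) = inj₂ (∣L0∣≢1 , refl)

  δ≡1 : ∣ L0 ∣ ≡ 1 → δL0 G L0 ≡ 1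
  δ≡1 ∣L0∣≡1 with δ-cases
  ... | inj₁ (_ , δ≡) = δ≡
  ... | inj₂ (∣L0∣≢1 , _) = ⊥-elim (∣L0∣≢1 ∣L0∣≡1)

  δ≡0 : 2 ≤ ∣ L0 ∣ → δL0 G L0 ≡ 0
  δ≡0 2≤∣L0∣ with δ-cases
  ... | inj₁ (∣L0∣≡1 , _) = ⊥-elim (<-irrefl (sym ∣L0∣≡1) 2≤∣L0∣)
  ... | inj₂ (_ , δ≡) = δ≡

  δ≤1 : δL0 G L0 ≤ 1
  δ≤1 with δ-cases
  ... | inj₁ (_ , δ≡) = ≤-reflexive δ≡
  ... | inj₂ (_ , δ≡) = subst (_≤ 1) (sym δ≡) z≤n

  -- Two distinct vertices cannot both lie in L0 when |L0| = 1.
  δ≤depth+depth : ∀ {u v} → u ≢ v → δL0 G L0 ≤ depth u + depth v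
  δ≤depth+depth {u} {v} u≢v with ∣L0∣≡1⊎2≤∣L0∣
  ... | inj₂ 2≤∣L0∣ = subst (_≤ depth u + depth v) (sym (δ≡0 2≤∣L0∣)) z≤n
  ... | inj₁ ∣L0∣≡1 with depth u + depth v in eq
  ...   | suc _ = subst (_≤ suc _) (sym (δ≡1 ∣L0∣≡1)) (s≤s z≤n)
  ...   | zero  = ⊥-elim (<-irrefl (sym ∣L0∣≡1) (x,y∈p⇒2≤∣p∣ (in-L0 u (m+n≡0⇒m≡0 _ eq)) (in-L0 v (m+n≡0⇒n≡0 (depth u) eq)) u≢v))
    where
    in-L0 : ∀ w → depth w ≡ 0 → w ∈ L0
    in-L0 w = to T-lookup⇔∈ ∘ to depth≡0⇔

module Characterisation {n : ℕ} (G : Graph (suc n)) (conn : Connected G) (L0 : Subset (suc n)) (nonempty : Nonempty L0) where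

  open Distance G conn
  open Labelings G conn
  open Layers G conn L0 nonempty

  d k δ D₁ : ℕ
  d  = diam G
  k  = kL0 G L0
  δ  = δL0 G L0
  D₁ = d ∸ k + 1

  formula⇔ : ∀ r → (ℤ.+ r ≡ (ℤ.+ (n * D₁) ℤ.+ ℤ.+ δ) ℤ.- ℤ.+ (2 * layerSum G L0)) ⇔ (r + 2 * sum depth ≡ n * D₁ + δ)
  formula⇔ r = ⇔-trans (ℤ-formula⇔ r (n * D₁) δ (2 * layerSum G L0))
    (mk⇔ (trans (cong (λ s → r + 2 * s) (sym layerSum≡∑depth))) (trans (cong (λ s → r + 2 * s) layerSum≡∑depth)))

  -- Condition (c) of the statement for consecutive vertices u, w, in additive form.
  Tight : (Fin (suc n) → ℕ) → Fin (suc n) → Fin (suc n) → Set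
  Tight φ u w = φ w + (depth u + depth w + k) ≡ φ u + (d + 1)

  condition-c⇔ : ∀ φ u w → (ℤ.+ φ w ≡ (((ℤ.+ φ u ℤ.+ ℤ.+ (d + 1)) ℤ.- ℤ.+ depth u) ℤ.- ℤ.+ depth w) ℤ.- ℤ.+ k) ⇔ Tight φ u w
  condition-c⇔ φ u w = ℤ-step⇔ (φ w) (φ u) (d + 1) (depth u) (depth w) k

  radio-consecutive : ∀ {φ u w} → IsRadioLabeling G φ → φ u < φ w → φ u + (d + 1) ≤ φ w + dist G u w
  radio-consecutive {φ} {u} {w} radio φu<φw = begin
    φ u + (d + 1)                      ≡⟨ cong (φ u +_) (+-comm d 1) ⟩
    φ u + suc d                        ≤⟨ +-monoʳ-≤ (φ u) (radio u w (λ { refl → <-irrefl refl φu<φw })) ⟩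
    φ u + (dist G u w + ∣ φ u - φ w ∣)  ≡⟨ cong (λ g → φ u + (dist G u w + g)) (m≤n⇒∣m-n∣≡n∸m (<⇒≤ φu<φw)) ⟩
    φ u + (dist G u w + (φ w ∸ φ u))   ≡⟨ cong (φ u +_) (+-comm (dist G u w) _) ⟩
    φ u + ((φ w ∸ φ u) + dist G u w)   ≡⟨ +-assoc (φ u) _ _ ⟨
    φ u + (φ w ∸ φ u) + dist G u w     ≡⟨ cong (_+ dist G u w) (m+[n∸m]≡n (<⇒≤ φu<φw)) ⟩
    φ w + dist G u w                   ∎
    where open ≤-Reasoning

  radio-gap : ∀ {φ u w} → IsRadioLabeling G φ → φ u < φ w → φ u + (d + 1) ≤ φ w + (depth u + depth w + k)
  radio-gap {φ} {u} {w} radio φu<φw = ≤-trans (radio-consecutive {φ} radio φu<φw) (+-monoʳ-≤ (φ w) (dist≤depth+depth+k u w))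

  tight⇒dist : ∀ {φ u w} → IsRadioLabeling G φ → φ u < φ w → Tight φ u w → dist G u w ≡ depth u + depth w + k
  tight⇒dist {φ} {u} {w} radio φu<φw tight = ≤-antisym (dist≤depth+depth+k u w)
    (+-cancelˡ-≤ (φ w) _ _ (subst (_≤ φ w + dist G u w) (sym tight) (radio-consecutive {φ} radio φu<φw)))

  d+1≡D₁+k : d + 1 ≡ D₁ + k
  d+1≡D₁+k = begin
    d + 1            ≡⟨ cong (_+ 1) (m∸n+n≡m k≤diam) ⟨
    d ∸ k + k + 1    ≡⟨ swap (d ∸ k) k ⟩
    d ∸ k + 1 + k    ∎
    where
    open ≡-Reasoning
    swap : ∀ x y → x + y + 1 ≡ x + 1 + y
    swap = solve-∀

  +d+1≡+D₁+k : ∀ a → a + (d + 1) ≡ a + D₁ + k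
  +d+1≡+D₁+k a = trans (cong (a +_) d+1≡D₁+k) (sym (+-assoc a D₁ k))

  drop-k-≤ : ∀ {a b s} → a + (d + 1) ≤ b + (s + k) → a + D₁ ≤ b + s
  drop-k-≤ {a} {b} {s} = +-cancelʳ-≤ k _ _ ∘ subst₂ _≤_ (+d+1≡+D₁+k a) (sym (+-assoc b s k))

  drop-k-≡ : ∀ {a b s} → (b + (s + k) ≡ a + (d + 1)) ⇔ (a + D₁ ≡ b + s)
  drop-k-≡ {a} {b} {s} = mk⇔
    (λ eq → +-cancelʳ-≡ k _ _ (trans (sym (+d+1≡+D₁+k a)) (trans (sym eq) (sym (+-assoc b s k)))))
    (λ eq → trans (sym (+-assoc b s k)) (trans (cong (_+ k) (sym eq)) (sym (+d+1≡+D₁+k a))))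

  module Ordered (φ : Fin (suc n) → ℕ) (radio : IsRadioLabeling G φ)
                 (x : Fin (suc n) → Fin (suc n)) (x-bijective : Bijective _≡_ _≡_ x)
                 (increasing : ∀ i → φ (x (inject₁ i)) < φ (x (suc i))) where

    step : ∀ i → φ (x (inject₁ i)) + D₁ ≤ φ (x (suc i)) + (depth (x (inject₁ i)) + depth (x (suc i)))
    step i = drop-k-≤ {φ (x (inject₁ i))} {φ (x (suc i))} (radio-gap {φ} radio (increasing i))

    ∑depth∘x : sum (depth ∘ x) ≡ sum depth
    ∑depth∘x = sym (∑-permute depth (⤖⇒↔ (mk⤖ x-bijective)))

    bound : φ (x zero) + n * D₁ + (depth (x zero) + depth (x (fromℕ n))) ≤ φ (x (fromℕ n)) + 2 * sum depth
    bound = subst (λ s → φ (x zero) + n * D₁ + (depth (x zero) + depth (x (fromℕ n))) ≤ φ (x (fromℕ n)) + 2 * s)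
                  ∑depth∘x (telescope-≤ D₁ (φ ∘ x) (depth ∘ x) step)

    bound-tight : (φ (x zero) + n * D₁ + (depth (x zero) + depth (x (fromℕ n))) ≡ φ (x (fromℕ n)) + 2 * sum depth) ⇔
                  (∀ i → Tight φ (x (inject₁ i)) (x (suc i)))
    bound-tight = mk⇔
      (λ eq i → from (drop-k-≡′ i) (to telescope (trans eq (cong (λ s → φ (x (fromℕ n)) + 2 * s) (sym ∑depth∘x))) i))
      (λ tights → trans (from telescope (λ i → to (drop-k-≡′ i) (tights i))) (cong (λ s → φ (x (fromℕ n)) + 2 * s) ∑depth∘x))
      where
      telescope : (φ (x zero) + n * D₁ + (depth (x zero) + depth (x (fromℕ n))) ≡ φ (x (fromℕ n)) + 2 * sum (depth ∘ x)) ⇔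
                  (∀ i → φ (x (inject₁ i)) + D₁ ≡ φ (x (suc i)) + (depth (x (inject₁ i)) + depth (x (suc i))))
      telescope = telescope-tight D₁ (φ ∘ x) (depth ∘ x) step
      drop-k-≡′ : ∀ i → Tight φ (x (inject₁ i)) (x (suc i)) ⇔
                        (φ (x (inject₁ i)) + D₁ ≡ φ (x (suc i)) + (depth (x (inject₁ i)) + depth (x (suc i))))
      drop-k-≡′ i = drop-k-≡ {φ (x (inject₁ i))} {φ (x (suc i))} {depth (x (inject₁ i)) + depth (x (suc i))}

  -- Under the formula, an optimal labeling listed by increasing label attains the bound.
  module ZeroBased {r : ℕ} (1≤n : 1 ≤ n) (formula : r + 2 * sum depth ≡ n * D₁ + δ)
                   (ψ : Fin (suc n) → ℕ) (radio : IsRadioLabeling G ψ) (span≡r : span G ψ ≡ r)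
                   (v₀ : Fin (suc n)) (ψv₀≡0 : ψ v₀ ≡ 0) where

    open Sorting ψ (radio-injective {ψ} radio) public

    increasing : ∀ i → ψ (sorted (inject₁ i)) < ψ (sorted (suc i))
    increasing i = sorted-< (s≤s (≤-reflexive (toℕ-inject₁ i)))

    open Ordered ψ radio sorted sorted-bijective increasing

    ψ-first : ψ (sorted zero) ≡ 0
    ψ-first = n≤0⇒n≡0 (subst (ψ (sorted zero) ≤_) ψv₀≡0 (sorted-least v₀))

    ψ-last : ψ (sorted (fromℕ n)) ≡ span G ψ
    ψ-last = sym (span-from-zero {ψ} ψ-first sorted-greatest)

    ψ-last≡r : ψ (sorted (fromℕ n)) ≡ r
    ψ-last≡r = trans ψ-last span≡r

    first≢last : sorted zero ≢ sorted (fromℕ n)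
    first≢last eq = <-irrefl (trans (cong toℕ (proj₁ sorted-bijective eq)) (toℕ-fromℕ n)) 1≤n

    endpoints≡δ : depth (sorted zero) + depth (sorted (fromℕ n)) ≡ δ
    endpoints≡δ = ≤-antisym (+-cancelˡ-≤ (n * D₁) _ _ (begin
      n * D₁ + (depth (sorted zero) + depth (sorted (fromℕ n)))
        ≡⟨ cong (λ a → a + n * D₁ + (depth (sorted zero) + depth (sorted (fromℕ n)))) ψ-first ⟨
      ψ (sorted zero) + n * D₁ + (depth (sorted zero) + depth (sorted (fromℕ n)))
        ≤⟨ bound ⟩
      ψ (sorted (fromℕ n)) + 2 * sum depth
        ≡⟨ cong (_+ 2 * sum depth) ψ-last≡r ⟩
      r + 2 * sum depth
        ≡⟨ formula ⟩
      n * D₁ + δ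
        ∎)) (δ≤depth+depth first≢last)
      where open ≤-Reasoning

    tight : ∀ i → Tight ψ (sorted (inject₁ i)) (sorted (suc i))
    tight = to bound-tight (begin
      ψ (sorted zero) + n * D₁ + (depth (sorted zero) + depth (sorted (fromℕ n)))
        ≡⟨ cong₂ (λ a e → a + n * D₁ + e) ψ-first endpoints≡δ ⟩
      n * D₁ + δ
        ≡⟨ formula ⟨
      r + 2 * sum depth
        ≡⟨ cong (_+ 2 * sum depth) ψ-last≡r ⟨
      ψ (sorted (fromℕ n)) + 2 * sum depth
        ∎)
      where open ≡-Reasoning

    first-or-last∈L0 : depth (sorted zero) ≡ 0 ⊎ depth (sorted (fromℕ n)) ≡ 0
    first-or-last∈L0 with depth (sorted zero) in eq
    ... | zero  = inj₁ refl
    ... | suc _ = inj₂ (n≤0⇒n≡0 (+-cancelˡ-≤ 1 _ 0 (≤-trans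
                    (+-monoˡ-≤ (depth (sorted (fromℕ n))) (subst (1 ≤_) (sym eq) (s≤s z≤n)))
                    (subst (_≤ 1) (sym endpoints≡δ) δ≤1))))

    goodOrdering : depth (sorted zero) ≡ 0 → GoodOrdering G L0 r ψ sorted
    goodOrdering first∈L0 =
        radio
      , sorted-bijective
      , at-zero ψ-first
      , (λ i j j≡1+i → sorted-< (≤-reflexive (sym j≡1+i)))
      , at-last ψ-last
      , span≡r
      , from ∀-consecutive⇔ (λ i → tight⇒dist {ψ} radio (increasing i) (tight i))
      , at-zero (to depth≡0⇔ first∈L0)
      , at-last ((λ 2≤∣L0∣ → to depth≡0⇔ (trans last≡δ (δ≡0 2≤∣L0∣)))
                , (λ ∣L0∣≡1 → from (layer⇔ 1) (trans last≡δ (δ≡1 ∣L0∣≡1))))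
      , from ∀-consecutive⇔ (λ i → from (condition-c⇔ ψ (sorted (inject₁ i)) (sorted (suc i))) (tight i))
      where
      last≡δ : depth (sorted (fromℕ n)) ≡ δ
      last≡δ = trans (cong (_+ depth (sorted (fromℕ n))) (sym first∈L0)) endpoints≡δ

  goodOrdering-from-zeroBased : ∀ {r} → 1 ≤ n → r + 2 * sum depth ≡ n * D₁ + δ →
    ∀ ψ → IsRadioLabeling G ψ → span G ψ ≡ r → ∀ v₀ → ψ v₀ ≡ 0 → ∃[ φ ] ∃[ x ] GoodOrdering G L0 r φ x
  goodOrdering-from-zeroBased {r} 1≤n formula ψ radio span≡r v₀ ψv₀≡0 = choose first-or-last∈L0
    where
    open ZeroBased 1≤n formula ψ radio span≡r v₀ ψv₀≡0
    -- If the listing of ψ ends in L0 rather than starting there, read it backwards.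
    ψ′ : Fin (suc n) → ℕ
    ψ′ v = r ∸ ψ v
    reflected : SameGaps ψ ψ′
    reflected u v = ∣o∸m-o∸n∣≡∣m-n∣ (ψ≤r u) (ψ≤r v)
      where
      ψ≤r : ∀ w → ψ w ≤ r
      ψ≤r w = subst (ψ w ≤_) ψ-last≡r (sorted-greatest w)
    ψ′-last : ψ′ (sorted (fromℕ n)) ≡ 0
    ψ′-last = trans (cong (r ∸_) ψ-last≡r) (n∸n≡0 r)
    radio′ : IsRadioLabeling G ψ′
    radio′ = radio-sameGaps {ψ} {ψ′} reflected radio
    module Z′ = ZeroBased 1≤n formula ψ′ radio′ (trans (span-sameGaps {ψ} {ψ′} reflected) span≡r) (sorted (fromℕ n)) ψ′-last
    choose : depth (sorted zero) ≡ 0 ⊎ depth (sorted (fromℕ n)) ≡ 0 → ∃[ φ ] ∃[ x ] GoodOrdering G L0 r φ x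
    choose (inj₁ first∈L0) = ψ , sorted , goodOrdering first∈L0
    choose (inj₂ last∈L0)  = ψ′ , Z′.sorted , Z′.goodOrdering
      (trans (cong depth (radio-injective {ψ′} radio′ {Z′.sorted zero} {sorted (fromℕ n)} (trans Z′.ψ-first (sym ψ′-last)))) last∈L0)

  goodOrdering-from-formula : ∀ {r} → 1 ≤ n → IsRadioNumber G r → r + 2 * sum depth ≡ n * D₁ + δ →
                              ∃[ φ ] ∃[ x ] GoodOrdering G L0 r φ x
  goodOrdering-from-formula 1≤n rn formula =
    let ψ , radio , span≡r , v₀ , ψv₀≡0 = zero-based rn in goodOrdering-from-zeroBased 1≤n formula ψ radio span≡r v₀ ψv₀≡0

  formula-from-goodOrdering : ∀ {r φ x} → GoodOrdering G L0 r φ x → r + 2 * sum depth ≡ n * D₁ + δ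
  formula-from-goodOrdering {r} {φ} {x} (radio , x-bijective , φ-first , consecutive , φ-last , span≡r , _ , first∈L0 , last-cond , condition-c) = begin
    r + 2 * sum depth
      ≡⟨ cong (_+ 2 * sum depth) (trans (φ-last (fromℕ n) (toℕ-fromℕ n)) span≡r) ⟨
    φ (x (fromℕ n)) + 2 * sum depth
      ≡⟨ from bound-tight (λ i → to (condition-c⇔ φ (x (inject₁ i)) (x (suc i))) (to ∀-consecutive⇔ condition-c i)) ⟨
    φ (x zero) + n * D₁ + (depth (x zero) + depth (x (fromℕ n)))
      ≡⟨ cong₂ (λ a e → a + n * D₁ + e) (φ-first zero refl) endpoints ⟩
    n * D₁ + δ
      ∎
    where
    open ≡-Reasoning
    open Ordered φ radio x x-bijective (to ∀-consecutive⇔ consecutive)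
    last≡δ : depth (x (fromℕ n)) ≡ δ
    last≡δ with ∣L0∣≡1⊎2≤∣L0∣ | last-cond (fromℕ n) (toℕ-fromℕ n)
    ... | inj₁ ∣L0∣≡1 | _ , in-L₁ = trans (to (layer⇔ 1) (in-L₁ ∣L0∣≡1)) (sym (δ≡1 ∣L0∣≡1))
    ... | inj₂ 2≤∣L0∣ | in-L0 , _ = trans (from depth≡0⇔ (in-L0 2≤∣L0∣)) (sym (δ≡0 2≤∣L0∣))
    endpoints : depth (x zero) + depth (x (fromℕ n)) ≡ δ
    endpoints = cong₂ _+_ (from depth≡0⇔ (first∈L0 zero refl)) last≡δ

open import Data.Integer using (+_)

theorem2 : ∀ {p : ℕ} (G : Graph p) → 2 ≤ p → Connected G →
    (L0 : Subset p) → Nonempty L0 → (r : ℕ) → IsRadioNumber G r →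
    ((+ r) ≡ ((+ ((p ∸ 1) * ((diam G ∸ kL0 G L0) + 1)) ℤ.+ + δL0 G L0) ℤ.- + (2 * layerSum G L0)))
      ⇔ (∃[ φ ] ∃[ x ] GoodOrdering G L0 r φ x)
theorem2 G (s≤s (s≤s _)) conn L0 nonempty r rn =
  mk⇔ (goodOrdering-from-formula (s≤s z≤n) rn ∘ to (formula⇔ r))
      (λ (φ , x , good) → from (formula⇔ r) (formula-from-goodOrdering {r} {φ} {x} good))
  where open Characterisation G conn L0 nonempty
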